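{- Let $p$ be a prime and let $Q \in \mathbb{Z}[x]$. Assume that every root of $Q$ in $\mathbb{Z}/p\mathbb{Z}$ satisfies the hypothesis of Hensel's lemma, i.e. for every $b \in \mathbb{Z}$ with $Q(b) \equiv 0 \pmod p$ one has $Q'(b) \not\equiv 0 \pmod p$. Let $$z_p := \left| \{ b \in \{1, 2, \ldots, p\} : Q(b) \equiv 0 \pmod p \} \right|.$$ Let $n_0 \geq 0$ be an integer exceeding every positive integer zero of $Q$, and define $t_{n_0} = 1$ and $t_n = Q(n)\, t_{n-1}$ for $n > n_0$ (so $t_n \neq 0$ for all $n \ge n_0$). Then $$\nu_p(t_n) \sim \frac{z_p\, n}{p-1} \quad \text{as } n \to \infty,$$ in the sense that $\lim_{n\to\infty} \frac{(p-1)\,\nu_p(t_n)}{n} = z_p$.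
   Context: For a nonzero rational $x$, the $p$-adic valuation $\nu_p(x)$ is the integer such that $x = p^{\nu_p(x)} a/b$ with $a,b \in \mathbb{Z}$ not divisible by $p$. $Q'$ denotes the formal derivative of $Q$. -}

module Defs where

open import Data.Nat as ℕ using (ℕ; zero; suc; _≤?_)
open import Data.Nat.Divisibility as ℕD using ()
open import Data.Integer using (ℤ; +_; _+_; _*_; _^_; ∣_∣)
open import Data.Integer.Divisibility using (_∣_)
open import Data.List using (List; []; _∷_; length; filter; map; upTo)
open import Data.Product using (∃; _×_)
open import Relation.Nullary using (¬_; yes; no)
open import Relation.Binary.PropositionalEquality using (_≡_)

-- Integer polynomials as coefficient lists, constant term first:
-- a₀ ∷ a₁ ∷ … ∷ aₖ ∷ []  represents  a₀ + a₁ x + … + aₖ xᵏ.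
Poly : Set
Poly = List ℤ

eval : Poly → ℤ → ℤ
eval []       x = + 0
eval (a ∷ as) x = a + x * eval as x

derivAux : ℕ → Poly → Poly
derivAux k []       = []
derivAux k (a ∷ as) = (+ k) * a ∷ derivAux (suc k) as

deriv : Poly → Poly
deriv []       = []
deriv (_ ∷ as) = derivAux 1 as

HasVal : ℕ → ℤ → ℕ → Set
HasVal p x k = ∃ λ (a : ℤ) → (x ≡ ((+ p) ^ k) * a) × ¬ ((+ p) ∣ a)

zp : ℕ → Poly → ℕ
zp p Q = length (filter (λ b → p ℕD.∣? ∣ eval Q (+ b) ∣) (map suc (upTo p)))

-- t_{n₀} = 1, t_n = Q(n) t_{n-1} for n > n₀ (value 1 also for n ≤ n₀,
-- which is irrelevant to the statement).
t : Poly → ℕ → ℕ → ℤ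
t Q n₀ zero = + 1
t Q n₀ (suc n) with suc n ≤? n₀
... | yes _ = + 1
... | no  _ = eval Q (+ suc n) * t Q n₀ n

module Submission where

-- Idea.  ν_p(t_n) = Σ_{n₀<j≤n} ν_p(Q(j))  and  ν_p(x) = Σ_{i≥1} [pⁱ ∣ x], so
-- swapping the sums,  ν_p(t_n) = Σ_{i≥1} #{j ∈ (n₀, n] : pⁱ ∣ Q(j)}.  By the
-- Taylor expansion [pⁱ ∣ Q(j)] is pⁱ-periodic in j, and by Hensel lifting
-- every block of pⁱ consecutive integers contains exactly z_p roots of Q
-- modulo pⁱ; hence the i-th term is ⌊L/pⁱ⌋·z_p up to an error z_p, where
-- L = n − n₀.  Summing over i ≤ K (a fixed level) gives a lower bound, and
-- summing up to a bound B = o(n) for all valuations gives an upper bound.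
-- Since Σ_i ⌊L/pⁱ⌋ = L/(p−1) + O(#terms), both become
-- den(ε)·|(p−1)·ν_p(t_n) − z_p·n| < n  for all large n, which is the
-- ε-statement about rationals.

open import Data.Nat using (ℕ)
import Data.Nat as ℕ
open import Data.Nat.Primality using (Prime)
import Data.Integer as ℤ
import Data.Integer.Divisibility as ℤ∣ᵤ
open import Defs using (Poly; eval; deriv)
open import Relation.Nullary using (¬_)
open import Relation.Binary.PropositionalEquality using (_≡_)

module FiniteSums where
  open import Data.Nat
  open import Data.Nat.Properties
  open import Relation.Binary.PropositionalEquality
  open import Relation.Nullary using (yes; no)
  open import Data.Nat.Tactic.RingSolver using (solve-∀)

  sum : (ℕ → ℕ) → ℕ → ℕ
  sum g zero    = 0
  sum g (suc L) = sum g L + g L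

  window : (ℕ → ℕ) → ℕ → ℕ → ℕ
  window g a L = sum (λ l → g (a + l)) L

  sum-ext : ∀ {g h} L → (∀ l → l < L → g l ≡ h l) → sum g L ≡ sum h L
  sum-ext zero    g≡h = refl
  sum-ext (suc L) g≡h =
    cong₂ _+_ (sum-ext L (λ l l<L → g≡h l (m<n⇒m<1+n l<L))) (g≡h L ≤-refl)

  sum-mono : ∀ {g h} L → (∀ l → g l ≤ h l) → sum g L ≤ sum h L
  sum-mono zero    g≤h = z≤n
  sum-mono (suc L) g≤h = +-mono-≤ (sum-mono L g≤h) (g≤h L)

  sum-head : ∀ g L → sum g (suc L) ≡ g 0 + sum (λ l → g (suc l)) L
  sum-head g zero    = +-comm 0 (g 0)
  sum-head g (suc L) = trans (cong (_+ g (suc L)) (sum-head g L)) (+-assoc (g 0) _ _)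

  sum-+ : ∀ g L L' → sum g (L + L') ≡ sum g L + window g L L'
  sum-+ g L zero     = trans (cong (sum g) (+-identityʳ L)) (sym (+-identityʳ _))
  sum-+ g L (suc L') = begin
    sum g (L + suc L')                        ≡⟨ cong (sum g) (+-suc L L') ⟩
    sum g (L + L') + g (L + L')               ≡⟨ cong (_+ g (L + L')) (sum-+ g L L') ⟩
    sum g L + window g L L' + g (L + L')      ≡⟨ +-assoc (sum g L) _ _ ⟩
    sum g L + window g L (suc L')             ∎
    where open ≡-Reasoning

  sum-mono-len : ∀ g {L L'} → L ≤ L' → sum g L ≤ sum g L'
  sum-mono-len g {L} {L'} L≤L' = begin
    sum g L                                   ≤⟨ m≤m+n (sum g L) _ ⟩
    sum g L + window g L (L' ∸ L)             ≡⟨ sum-+ g L (L' ∸ L) ⟨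
    sum g (L + (L' ∸ L))                      ≡⟨ cong (sum g) (m+[n∸m]≡n L≤L') ⟩
    sum g L'                                  ∎
    where open ≤-Reasoning

  sum-distrib : ∀ g h L → sum (λ l → g l + h l) L ≡ sum g L + sum h L
  sum-distrib g h zero    = refl
  sum-distrib g h (suc L) =
    trans (cong (_+ (g L + h L)) (sum-distrib g h L)) (interchange (sum g L) (sum h L) (g L) (h L))
    where
    interchange : ∀ a b c d → a + b + (c + d) ≡ a + c + (b + d)
    interchange = solve-∀

  sum-const : ∀ c L → sum (λ _ → c) L ≡ L * c
  sum-const c zero    = refl
  sum-const c (suc L) = trans (cong (_+ c) (sum-const c L)) (+-comm (L * c) c)

  sum-*ʳ : ∀ g c L → sum (λ l → g l * c) L ≡ sum g L * c
  sum-*ʳ g c zero    = refl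
  sum-*ʳ g c (suc L) = trans (cong (_+ g L * c) (sum-*ʳ g c L)) (sym (*-distribʳ-+ c (sum g L) (g L)))

  sum-swap : ∀ (h : ℕ → ℕ → ℕ) A B →
    sum (λ a → sum (λ b → h a b) B) A ≡ sum (λ b → sum (λ a → h a b) A) B
  sum-swap h zero    B = sym (trans (sum-const 0 B) (*-zeroʳ B))
  sum-swap h (suc A) B =
    trans (cong (_+ sum (h A) B) (sum-swap h A B))
          (sym (sum-distrib (λ b → sum (λ a → h a b) A) (h A) B))

  sum-zero : ∀ g L → (∀ l → l < L → g l ≡ 0) → sum g L ≡ 0
  sum-zero g L g≡0 = trans (sum-ext L g≡0) (trans (sum-const 0 L) (*-zeroʳ L))

  sum-single : ∀ g L l₀ → l₀ < L → g l₀ ≡ 1 → (∀ l → l < L → l ≢ l₀ → g l ≡ 0) → sum g L ≡ 1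
  sum-single g (suc L) l₀ l₀<1+L g₀≡1 others with l₀ ≟ L
  ... | yes refl = cong₂ _+_ (sum-zero g L (λ l l<L → others l (m<n⇒m<1+n l<L) (<⇒≢ l<L))) g₀≡1
  ... | no l₀≢L  = cong₂ _+_
        (sum-single g L l₀ (≤∧≢⇒< (≤-pred l₀<1+L) l₀≢L) g₀≡1 (λ l l<L → others l (m<n⇒m<1+n l<L)))
        (others L ≤-refl (≢-sym l₀≢L))

  window-blocks : ∀ g a P q → window g a (q * P) ≡ sum (λ s → window g (a + s * P) P) q
  window-blocks g a P zero    = refl
  window-blocks g a P (suc q) = begin
    window g a (P + q * P)                                     ≡⟨ cong (window g a) (+-comm P (q * P)) ⟩
    window g a (q * P + P)                                     ≡⟨ sum-+ _ (q * P) P ⟩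
    window g a (q * P) + window (λ l → g (a + l)) (q * P) P     ≡⟨ cong₂ _+_ (window-blocks g a P q)
                                                                     (sum-ext P (λ l _ → cong g (sym (+-assoc a (q * P) l)))) ⟩
    sum (λ s → window g (a + s * P) P) q + window g (a + q * P) P ∎
    where open ≡-Reasoning

  window-residues : ∀ g a P q →
    window g a (q * P) ≡ window (λ x → sum (λ s → g (x + s * P)) q) a P
  window-residues g a P q = begin
    window g a (q * P)                                         ≡⟨ window-blocks g a P q ⟩
    sum (λ s → window g (a + s * P) P) q                       ≡⟨ sum-swap (λ s l → g (a + s * P + l)) q P ⟩
    sum (λ l → sum (λ s → g (a + s * P + l)) q) P              ≡⟨ sum-ext P (λ l _ → sum-ext q (λ s _ → cong g (reorder a (s * P) l))) ⟩
    window (λ x → sum (λ s → g (x + s * P)) q) a P             ∎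
    where
    open ≡-Reasoning
    reorder : ∀ a b l → a + b + l ≡ a + l + b
    reorder a b l = trans (+-assoc a b l) (trans (cong (a +_) (+-comm b l)) (sym (+-assoc a l b)))

  window-periodic : ∀ g P → (∀ x → g (x + P) ≡ g x) → ∀ a → window g a P ≡ window g 0 P
  window-periodic g P per zero    = refl
  window-periodic g P per (suc a) = trans (+-cancelʳ-≡ (g a) _ _ slide) (window-periodic g P per a)
    where
    open ≡-Reasoning
    slide : window g (suc a) P + g a ≡ window g a P + g a
    slide = begin
      window g (suc a) P + g a                           ≡⟨ +-comm _ (g a) ⟩
      g a + window g (suc a) P                           ≡⟨ cong₂ _+_ (cong g (+-identityʳ a))
                                                             (sum-ext P (λ l _ → cong g (+-suc a l))) ⟨
      g (a + 0) + sum (λ l → g (a + suc l)) P            ≡⟨ sum-head (λ l → g (a + l)) P ⟨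
      window g a (suc P)                                 ≡⟨ cong (window g a P +_) (per a) ⟩
      window g a P + g a                                 ∎

  module _ (g : ℕ → ℕ) (P z : ℕ) (uniform : ∀ a → window g a P ≡ z) where

    window-multiple : ∀ a q → window g a (q * P) ≡ q * z
    window-multiple a q = begin
      window g a (q * P)                    ≡⟨ window-blocks g a P q ⟩
      sum (λ s → window g (a + s * P) P) q  ≡⟨ sum-ext q (λ s _ → uniform (a + s * P)) ⟩
      sum (λ _ → z) q                       ≡⟨ sum-const z q ⟩
      q * z                                 ∎
      where open ≡-Reasoning

    window-≥ : ∀ a L q → q * P ≤ L → q * z ≤ window g a L
    window-≥ a L q qP≤L = ≤-trans (≤-reflexive (sym (window-multiple a q))) (sum-mono-len _ qP≤L)

    window-≤ : ∀ a L q → L ≤ q * P → window g a L ≤ q * z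
    window-≤ a L q L≤qP = ≤-trans (sum-mono-len _ L≤qP) (≤-reflexive (window-multiple a q))

-- Taylor expansion to first order of an integer polynomial:
--   Q(x + h) = Q(x) + h·Q'(x) + h²·R   for some integer R.
-- This drives both the periodicity of Q modulo m and Hensel lifting.
module PolynomialExpansion where
  open import Defs
  open import Data.Integer using (+_; _+_; _*_; 1ℤ)
  open import Data.Integer.Properties using (*-zeroˡ; *-zeroʳ; +-identityˡ; +-comm)
  open import Data.Integer.Divisibility.Signed using (_∣_; ∣m+n∣n⇒∣m; ∣m∣n⇒∣m+n; ∣m⇒∣m*n)
  open import Data.Integer.Tactic.RingSolver using (solve-∀)
  open import Data.List using ([]; _∷_)
  open import Data.Nat using (suc)
  open import Data.Product using (∃; _,_)
  open import Relation.Binary.PropositionalEquality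

  private
    -- The weight k in derivAux k contributes one copy of the polynomial per step.
    eval-derivAux-suc : ∀ k as x → eval (derivAux (suc k) as) x ≡ eval (derivAux k as) x + eval as x
    eval-derivAux-suc k []       x = refl
    eval-derivAux-suc k (a ∷ as) x = begin
      + suc k * a + x * eval (derivAux (suc (suc k)) as) x
        ≡⟨ cong (λ w → + suc k * a + x * w) (eval-derivAux-suc (suc k) as x) ⟩
      + suc k * a + x * (eval (derivAux (suc k) as) x + eval as x)
        ≡⟨ regroup (+ k) a x (eval (derivAux (suc k) as) x) (eval as x) ⟩
      (+ k * a + x * eval (derivAux (suc k) as) x) + (a + x * eval as x) ∎
      where
      open ≡-Reasoning
      regroup : ∀ K a x D E → (1ℤ + K) * a + x * (D + E) ≡ (K * a + x * D) + (a + x * E)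
      regroup = solve-∀

    eval-derivAux-zero : ∀ as x → eval (derivAux 0 as) x ≡ x * eval (deriv as) x
    eval-derivAux-zero []       x = sym (*-zeroʳ x)
    eval-derivAux-zero (a ∷ as) x =
      trans (cong (_+ x * eval (derivAux 1 as) x) (*-zeroˡ a)) (+-identityˡ _)

  eval-deriv-∷ : ∀ a as x → eval (deriv (a ∷ as)) x ≡ eval as x + x * eval (deriv as) x
  eval-deriv-∷ a as x = begin
    eval (derivAux 1 as) x                  ≡⟨ eval-derivAux-suc 0 as x ⟩
    eval (derivAux 0 as) x + eval as x      ≡⟨ cong (_+ eval as x) (eval-derivAux-zero as x) ⟩
    x * eval (deriv as) x + eval as x       ≡⟨ +-comm (x * eval (deriv as) x) (eval as x) ⟩
    eval as x + x * eval (deriv as) x       ∎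
    where open ≡-Reasoning

  taylor : ∀ Q x h → ∃ λ R → eval Q (x + h) ≡ eval Q x + h * eval (deriv Q) x + h * h * R
  taylor []       x h = + 0 , vanish x h
    where
    vanish : ∀ x h → + 0 ≡ + 0 + h * + 0 + h * h * + 0
    vanish = solve-∀
  taylor (a ∷ as) x h with taylor as x h
  ... | R , expand = eval (deriv as) x + x * R + h * R , (begin
      a + (x + h) * eval as (x + h)
    ≡⟨ cong (λ w → a + (x + h) * w) expand ⟩
      a + (x + h) * (eval as x + h * eval (deriv as) x + h * h * R)
    ≡⟨ regroup a x h (eval as x) (eval (deriv as) x) R ⟩
      a + x * eval as x + h * (eval as x + x * eval (deriv as) x) + h * h * (eval (deriv as) x + x * R + h * R)
    ≡⟨ cong (λ w → a + x * eval as x + h * w + h * h * (eval (deriv as) x + x * R + h * R)) (eval-deriv-∷ a as x) ⟨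
      a + x * eval as x + h * eval (deriv (a ∷ as)) x + h * h * (eval (deriv as) x + x * R + h * R) ∎)
    where
    open ≡-Reasoning
    regroup : ∀ a x h E E' R → a + (x + h) * (E + h * E' + h * h * R)
                             ≡ a + x * E + h * (E + x * E') + h * h * (E' + x * R + h * R)
    regroup = solve-∀

  increment : ∀ Q x h → ∃ λ W → eval Q (x + h) ≡ eval Q x + h * W
  increment Q x h with taylor Q x h
  ... | R , expand = eval (deriv Q) x + h * R , trans expand (first-order (eval Q x) h (eval (deriv Q) x) R)
    where
    first-order : ∀ E h E' R → E + h * E' + h * h * R ≡ E + h * (E' + h * R)
    first-order = solve-∀

  ∣-shift⇒ : ∀ Q d x h → d ∣ h → d ∣ eval Q (x + h) → d ∣ eval Q x
  ∣-shift⇒ Q d x h d∣h d∣Qxh with increment Q x h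
  ... | W , eq = ∣m+n∣n⇒∣m (subst (d ∣_) eq d∣Qxh) (∣m⇒∣m*n W d∣h)

  ∣-shift⇐ : ∀ Q d x h → d ∣ h → d ∣ eval Q x → d ∣ eval Q (x + h)
  ∣-shift⇐ Q d x h d∣h d∣Qx with increment Q x h
  ... | W , eq = subst (d ∣_) (sym eq) (∣m∣n⇒∣m+n d∣Qx (∣m⇒∣m*n W d∣h))

module DivisibilityIndicator where
  open import Data.Nat using (ℕ; zero; suc; _+_)
  open import Data.Nat.Divisibility using (_∣_; _∣?_)
  open import Data.List using (length; filter; applyUpTo)
  open import Data.Empty using (⊥-elim)
  open import Function using (_∘_)
  open import Relation.Nullary using (¬_; yes; no)
  open import Relation.Binary.PropositionalEquality using (_≡_; refl; cong₂; trans; sym)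
  open FiniteSums using (sum; sum-head)

  𝟙[_∣_] : ℕ → ℕ → ℕ
  𝟙[ d ∣ x ] with d ∣? x
  ... | yes _ = 1
  ... | no  _ = 0

  𝟙-yes : ∀ {d x} → d ∣ x → 𝟙[ d ∣ x ] ≡ 1
  𝟙-yes {d} {x} d∣x with d ∣? x
  ... | yes _   = refl
  ... | no  d∤x = ⊥-elim (d∤x d∣x)

  𝟙-no : ∀ {d x} → ¬ d ∣ x → 𝟙[ d ∣ x ] ≡ 0
  𝟙-no {d} {x} d∤x with d ∣? x
  ... | yes d∣x = ⊥-elim (d∤x d∣x)
  ... | no  _   = refl

  length-filter-∣ : ∀ d (f g : ℕ → ℕ) n →
    length (filter (λ b → d ∣? f b) (applyUpTo g n)) ≡ sum (λ l → 𝟙[ d ∣ f (g l) ]) n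
  length-filter-∣ d f g zero    = refl
  length-filter-∣ d f g (suc n) with d ∣? f (g 0)
  ... | yes d∣ = trans (cong₂ _+_ (sym (𝟙-yes d∣)) (length-filter-∣ d f (g ∘ suc) n))
                       (sym (sum-head (λ l → 𝟙[ d ∣ f (g l) ]) n))
  ... | no  d∤ = trans (cong₂ _+_ (sym (𝟙-no d∤)) (length-filter-∣ d f (g ∘ suc) n))
                       (sym (sum-head (λ l → 𝟙[ d ∣ f (g l) ]) n))

module Valuation (p : ℕ) (p-prime : Prime p) where
  open import Data.Nat
  open import Data.Nat.Properties
  open import Data.Nat.Divisibility
  open import Data.Nat.Induction using (<-rec)
  open import Data.Nat.Primality using (euclidsLemma; prime⇒nonZero; prime⇒nonTrivial)
  open import Data.Product using (∃; _,_; proj₁; proj₂)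
  open import Data.Sum using ([_,_]′)
  open import Data.Empty using (⊥-elim)
  open import Relation.Nullary using (¬_; yes; no)
  open import Relation.Binary.PropositionalEquality
  open import Relation.Binary.Definitions using (tri<; tri≈; tri>)
  open import Data.Nat.Tactic.RingSolver using (solve-∀)
  open import Defs using (HasVal)
  import Data.Integer as ℤ
  import Data.Integer.Properties as ℤP
  open FiniteSums
  open DivisibilityIndicator

  instance
    p≢0 : NonZero p
    p≢0 = prime⇒nonZero p-prime

  1<p : 1 < p
  1<p = nonTrivial⇒n>1 p {{prime⇒nonTrivial p-prime}}

  pᵛ≢0 : ∀ v → NonZero (p ^ v)
  pᵛ≢0 v = m^n≢0 p v

  record Val (x v : ℕ) : Set where
    constructor factor
    field
      unit       : ℕ
      x≡pᵛ*unit  : x ≡ p ^ v * unit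
      p∤unit     : ¬ p ∣ unit

  val-exists : ∀ x → 0 < x → ∃ (Val x)
  val-exists = <-rec (λ x → 0 < x → ∃ (Val x)) divide-out
    where
    divide-out : ∀ x → (∀ {y} → y < x → 0 < y → ∃ (Val y)) → 0 < x → ∃ (Val x)
    divide-out x rec 0<x with p ∣? x
    ... | no p∤x = 0 , factor x (sym (+-identityʳ x)) p∤x
    ... | yes (divides q x≡q*p) with rec q<x 0<q
      where
      0<q : 0 < q
      0<q = n≢0⇒n>0 (λ { refl → <⇒≢ 0<x (sym x≡q*p) })
      q<x : q < x
      q<x = subst (q <_) (sym x≡q*p) (m<m*n q p {{>-nonZero 0<q}} 1<p)
    ...   | v , factor a q≡pᵛa p∤a = suc v , factor a (trans x≡q*p (trans (cong (_* p) q≡pᵛa) (reassoc (p ^ v) a p))) p∤a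
      where
      reassoc : ∀ P a p → P * a * p ≡ p * P * a
      reassoc = solve-∀

  val-1 : Val 1 0
  val-1 = factor 1 refl (λ p∣1 → <⇒≱ 1<p (∣⇒≤ p∣1))

  HasVal⇒Val : ∀ {x k} → HasVal p x k → Val (ℤ.∣ x ∣) k
  HasVal⇒Val {k = k} (a , x≡pᵏa , p∤a) = factor ℤ.∣ a ∣
    (trans (cong ℤ.∣_∣ x≡pᵏa) (trans (ℤP.abs-* ((ℤ.+ p) ℤ.^ k) a) (cong (_* ℤ.∣ a ∣) (∣+p^k∣ k)))) p∤a
    where
    ∣+p^k∣ : ∀ k → ℤ.∣ (ℤ.+ p) ℤ.^ k ∣ ≡ p ^ k
    ∣+p^k∣ zero    = refl
    ∣+p^k∣ (suc k) = trans (ℤP.abs-* (ℤ.+ p) ((ℤ.+ p) ℤ.^ k)) (cong (p *_) (∣+p^k∣ k))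

  -- The valuation as a function (with the conventional value 0 at x = 0).
  val : ℕ → ℕ
  val zero    = 0
  val (suc x) = proj₁ (val-exists (suc x) z<s)

  val-spec : ∀ x → 0 < x → Val x (val x)
  val-spec (suc x) _ = proj₂ (val-exists (suc x) z<s)

  pow-∣ : ∀ {i v} → i ≤ v → p ^ i ∣ p ^ v
  pow-∣ {i} {v} i≤v = divides (p ^ (v ∸ i)) (begin
    p ^ v                 ≡⟨ cong (p ^_) (m+[n∸m]≡n i≤v) ⟨
    p ^ (i + (v ∸ i))     ≡⟨ ^-distribˡ-+-* p i (v ∸ i) ⟩
    p ^ i * p ^ (v ∸ i)   ≡⟨ *-comm (p ^ i) (p ^ (v ∸ i)) ⟩
    p ^ (v ∸ i) * p ^ i   ∎)
    where open ≡-Reasoning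

  val-divides : ∀ {x v i} → Val x v → i ≤ v → p ^ i ∣ x
  val-divides {v = v} (factor a x≡pᵛa _) i≤v =
    ∣-trans (pow-∣ i≤v) (subst (p ^ v ∣_) (sym x≡pᵛa) (m∣m*n a))

  val-not-divides : ∀ {x v i} → Val x v → v < i → ¬ p ^ i ∣ x
  val-not-divides {x} {v} {i} (factor a x≡pᵛa p∤a) v<i pⁱ∣x =
    p∤a (*-cancelˡ-∣ (p ^ v) {{pᵛ≢0 v}} pᵛp∣pᵛa)
    where
    pᵛp∣pᵛa : p ^ v * p ∣ p ^ v * a
    pᵛp∣pᵛa = subst₂ _∣_ (*-comm p (p ^ v)) x≡pᵛa (∣-trans (pow-∣ v<i) pⁱ∣x)

  val-unique : ∀ {x v w} → Val x v → Val x w → v ≡ w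
  val-unique {v = v} {w} xᵥ x_w with <-cmp v w
  ... | tri< v<w _ _ = ⊥-elim (val-not-divides xᵥ v<w (val-divides x_w ≤-refl))
  ... | tri≈ _ v≡w _ = v≡w
  ... | tri> _ _ w<v = ⊥-elim (val-not-divides x_w w<v (val-divides xᵥ ≤-refl))

  -- Additivity, using Euclid's lemma for the unit parts.
  val-* : ∀ {x y v w} → Val x v → Val y w → Val (x * y) (v + w)
  val-* {v = v} {w} (factor a x≡pᵛa p∤a) (factor b y≡pʷb p∤b) = factor (a * b)
    (trans (cong₂ _*_ x≡pᵛa y≡pʷb)
           (trans (reassoc (p ^ v) (p ^ w) a b) (cong (_* (a * b)) (sym (^-distribˡ-+-* p v w)))))
    (λ p∣ab → [ p∤a , p∤b ]′ (euclidsLemma a b p-prime p∣ab))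
    where
    reassoc : ∀ A B a b → A * a * (B * b) ≡ A * B * (a * b)
    reassoc = solve-∀

  pᵛ≤x : ∀ {x v} → Val x v → 0 < x → p ^ v ≤ x
  pᵛ≤x {v = v} (factor zero x≡0 _) 0<x = ⊥-elim (<⇒≢ 0<x (sym (trans x≡0 (*-zeroʳ (p ^ v)))))
  pᵛ≤x {v = v} (factor (suc a) x≡pᵛa _) _ = subst (p ^ v ≤_) (sym x≡pᵛa) (m≤m*n (p ^ v) (suc a))

  val-≤ : ∀ {x v} B → Val x v → 0 < x → x < p ^ suc B → v ≤ B
  val-≤ {v = v} B xᵥ 0<x x<pᴮ⁺¹ with v ≤? B
  ... | yes v≤B = v≤B
  ... | no  v≰B = ⊥-elim (<⇒≱ x<pᴮ⁺¹ (≤-trans (^-monoʳ-≤ p (≰⇒> v≰B)) (pᵛ≤x xᵥ 0<x)))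

  truncated-valuation : ∀ {x v} → Val x v → ∀ K → sum (λ i → 𝟙[ p ^ suc i ∣ x ]) K ≡ K ⊓ v
  truncated-valuation xᵥ zero = refl
  truncated-valuation {x} {v} xᵥ (suc K) with suc K ≤? v
  ... | yes K<v = begin
    sum (λ i → 𝟙[ p ^ suc i ∣ x ]) K + 𝟙[ p ^ suc K ∣ x ]  ≡⟨ cong₂ _+_ (truncated-valuation xᵥ K) (𝟙-yes (val-divides xᵥ K<v)) ⟩
    K ⊓ v + 1                                             ≡⟨ cong (_+ 1) (m≤n⇒m⊓n≡m (<⇒≤ K<v)) ⟩
    K + 1                                                 ≡⟨ +-comm K 1 ⟩
    suc K                                                 ≡⟨ m≤n⇒m⊓n≡m K<v ⟨
    suc K ⊓ v                                             ∎
    where open ≡-Reasoning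
  ... | no  K≮v = begin
    sum (λ i → 𝟙[ p ^ suc i ∣ x ]) K + 𝟙[ p ^ suc K ∣ x ]  ≡⟨ cong₂ _+_ (truncated-valuation xᵥ K) (𝟙-no (val-not-divides xᵥ (≰⇒> K≮v))) ⟩
    K ⊓ v + 0                                             ≡⟨ +-identityʳ _ ⟩
    K ⊓ v                                                 ≡⟨ m≥n⇒m⊓n≡n v≤K ⟩
    v                                                     ≡⟨ m≥n⇒m⊓n≡n (m≤n⇒m≤1+n v≤K) ⟨
    suc K ⊓ v                                             ∎
    where
    open ≡-Reasoning
    v≤K : v ≤ K
    v≤K = ≤-pred (≰⇒> K≮v)

module NaturalDistance where
  open import Data.Nat as ℕ using (NonZero; ∣_-_∣; _<_; _+_; _∸_)
  import Data.Nat.Properties as ℕP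
  open import Data.Integer as ℤ using (_⊖_)
  import Data.Integer.Properties as ℤP
  open import Data.Sum using (inj₁; inj₂)
  open import Relation.Binary.PropositionalEquality

  ∣⊖∣≡∣-∣ : ∀ a b → ℤ.∣ a ⊖ b ∣ ≡ ∣ a - b ∣
  ∣⊖∣≡∣-∣ a b with ℕP.≤-total a b
  ... | inj₁ a≤b = trans (ℤP.∣⊖∣-≤ a≤b) (sym (ℕP.m≤n⇒∣m-n∣≡n∸m a≤b))
  ... | inj₂ b≤a = begin
    ℤ.∣ a ⊖ b ∣   ≡⟨ ℤP.∣m⊖n∣≡∣n⊖m∣ a b ⟩
    ℤ.∣ b ⊖ a ∣   ≡⟨ ℤP.∣⊖∣-≤ b≤a ⟩
    a ∸ b         ≡⟨ ℕP.m≤n⇒∣n-m∣≡n∸m b≤a ⟨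
    ∣ a - b ∣     ∎
    where open ≡-Reasoning

  distance< : ∀ a b n .{{_ : NonZero n}} → a < b + n → b < a + n → ∣ a - b ∣ < n
  distance< a b n a<b+n b<a+n with ℕP.∣m-n∣≡[m∸n]∨[n∸m] a b
  ... | inj₁ ∣a-b∣≡a∸b = subst (_< n) (sym ∣a-b∣≡a∸b) (ℕP.m<n+o⇒m∸n<o a b a<b+n)
  ... | inj₂ ∣a-b∣≡b∸a = subst (_< n) (sym ∣a-b∣≡b∸a) (ℕP.m<n+o⇒m∸n<o b a b<a+n)

module LinearCongruence (p : ℕ) (p-prime : Prime p) where
  open import Data.Nat as ℕ using (ℕ; suc; _<_)
  import Data.Nat.Properties as ℕP
  import Data.Nat.Divisibility as ℕD
  open import Data.Nat.Coprimality using (Coprime; coprime-Bézout)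
  open import Data.Nat.GCD using (module Bézout)
  open import Data.Nat.Primality using (euclidsLemma; prime⇒irreducible)
  open import Data.Integer using (ℤ; +_; -[1+_]; _+_; _*_; _-_; -_; ∣_∣)
  import Data.Integer.Properties as ℤP
  open import Data.Integer.Divisibility.Signed using (_∣_; divides; ∣⇒∣ᵤ; ∣m∣n⇒∣m-n)
  open import Data.Integer.DivMod using (_%ℕ_; _/ℕ_; a≡a%ℕn+[a/ℕn]*n; n%ℕd<d)
  open import Data.Integer.Tactic.RingSolver using (solve-∀)
  open import Data.Product using (∃; _×_; _,_)
  open import Data.Sum using (inj₁; inj₂; [_,_]′)
  open import Data.Empty using (⊥-elim)
  open import Relation.Nullary using (¬_)
  open import Relation.Binary.PropositionalEquality
  open NaturalDistance using (∣⊖∣≡∣-∣)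
  open Valuation p p-prime using (p≢0)

  private
    p∤⇒coprime : ∀ {m} → ¬ p ℕD.∣ m → Coprime p m
    p∤⇒coprime p∤m (d∣p , d∣m) with prime⇒irreducible p-prime d∣p
    ... | inj₁ d≡1 = d≡1
    ... | inj₂ refl = ⊥-elim (p∤m d∣m)

    pos-1+ab : ∀ a b → + (1 ℕ.+ a ℕ.* b) ≡ + 1 + + a * + b
    pos-1+ab a b = trans (ℤP.pos-+ 1 (a ℕ.* b)) (cong (λ e → + 1 + e) (ℤP.pos-* a b))

    inverse-ℕ : ∀ m → ¬ p ℕD.∣ m → ∃ λ w → + p ∣ + 1 + + m * w
    inverse-ℕ m p∤m with coprime-Bézout (p∤⇒coprime p∤m)
    ... | Bézout.+- x y 1+ym≡xp = + y , divides (+ x) (begin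
      + 1 + + m * + y      ≡⟨ cong (λ e → + 1 + e) (ℤP.*-comm (+ m) (+ y)) ⟩
      + 1 + + y * + m      ≡⟨ pos-1+ab y m ⟨
      + (1 ℕ.+ y ℕ.* m)    ≡⟨ cong +_ 1+ym≡xp ⟩
      + (x ℕ.* p)          ≡⟨ ℤP.pos-* x p ⟩
      + x * + p            ∎)
      where open ≡-Reasoning
    ... | Bézout.-+ x y 1+xp≡ym = - + y , divides (- + x) (begin
      + 1 + + m * - + y                       ≡⟨ regroup (+ 1) (+ x) (+ y) (+ m) (+ p) ⟩
      (+ 1 + + x * + p) - + y * + m - + x * + p ≡⟨ cong (λ e → e - + y * + m - + x * + p) (pos-1+ab x p) ⟨
      + (1 ℕ.+ x ℕ.* p) - + y * + m - + x * + p ≡⟨ cong (λ e → + e - + y * + m - + x * + p) 1+xp≡ym ⟩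
      + (y ℕ.* m) - + y * + m - + x * + p       ≡⟨ cong (λ e → e - + y * + m - + x * + p) (ℤP.pos-* y m) ⟩
      + y * + m - + y * + m - + x * + p         ≡⟨ cancel (+ y * + m) (+ x) (+ p) ⟩
      - + x * + p                               ∎)
      where
      open ≡-Reasoning
      regroup : ∀ o x y m p → o + m * - y ≡ (o + x * p) - y * m - x * p
      regroup = solve-∀
      cancel : ∀ a x p → a - a - x * p ≡ - x * p
      cancel = solve-∀

  unit-inverse : ∀ u → ¬ p ℕD.∣ ∣ u ∣ → ∃ λ w → + p ∣ + 1 + u * w
  unit-inverse (+ m)    p∤u = inverse-ℕ m p∤u
  unit-inverse -[1+ n ] p∤u with inverse-ℕ (suc n) p∤u
  ... | w , p∣1+mw = - w , subst (λ e → + p ∣ + 1 + e) (neg-neg (+ suc n) w) p∣1+mw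
    where
    neg-neg : ∀ a w → a * w ≡ (- a) * (- w)
    neg-neg = solve-∀

  -- Existence: t = (−c·u⁻¹) reduced mod p, computed as  (c·w) mod p  where
  -- u·w ≡ −1.
  digit-exists : ∀ c u → ¬ p ℕD.∣ ∣ u ∣ → ∃ λ t → t < p × + p ∣ c + + t * u
  digit-exists c u p∤u with unit-inverse u p∤u
  ... | w , divides k 1+uw≡kp = t , n%ℕd<d (c * w) p , divides (c * k - q * u) (begin
    c + + t * u                          ≡⟨ cong (λ e → c + e * u) t≡cw-qp ⟩
    c + (c * w - q * + p) * u            ≡⟨ regroup c w q (+ p) u ⟩
    c * (+ 1 + u * w) - q * u * + p      ≡⟨ cong (λ e → c * e - q * u * + p) 1+uw≡kp ⟩
    c * (k * + p) - q * u * + p          ≡⟨ factor-p c k q (+ p) u ⟩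
    (c * k - q * u) * + p                ∎)
    where
    open ≡-Reasoning
    t : ℕ
    t = (c * w) %ℕ p
    q : ℤ
    q = (c * w) /ℕ p
    t≡cw-qp : + t ≡ c * w - q * + p
    t≡cw-qp = trans (sym (add-sub (+ t) (q * + p))) (cong (_- q * + p) (sym (a≡a%ℕn+[a/ℕn]*n (c * w) p)))
      where
      add-sub : ∀ a b → a + b - b ≡ a
      add-sub = solve-∀
    regroup : ∀ c w q P u → c + (c * w - q * P) * u ≡ c * (+ 1 + u * w) - q * u * P
    regroup = solve-∀
    factor-p : ∀ c k q P u → c * (k * P) - q * u * P ≡ (c * k - q * u) * P
    factor-p = solve-∀

  -- Uniqueness: p divides (t − t')·u, hence |t − t'| < p, hence t = t'.
  digit-unique : ∀ c u → ¬ p ℕD.∣ ∣ u ∣ → ∀ {t t'} → t < p → t' < p →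
    + p ∣ c + + t * u → + p ∣ c + + t' * u → t ≡ t'
  digit-unique c u p∤u {t} {t'} t<p t'<p p∣c+tu p∣c+t'u =
    ℕP.∣m-n∣≡0⇒m≡n (small-multiple (ℕP.≤-<-trans (ℕP.∣m-n∣≤m⊔n t t') (ℕP.⊔-lub t<p t'<p)) p∣dist)
    where
    p∣difference : + p ∣ (+ t - + t') * u
    p∣difference = subst (+ p ∣_) (difference c (+ t) (+ t') u) (∣m∣n⇒∣m-n p∣c+tu p∣c+t'u)
      where
      difference : ∀ c a b u → c + a * u - (c + b * u) ≡ (a - b) * u
      difference = solve-∀
    p∣dist : p ℕD.∣ ℕ.∣ t - t' ∣
    p∣dist = [ (λ p∣∣t-t'∣ → subst (p ℕD.∣_) (trans (cong ∣_∣ (ℤP.[+m]-[+n]≡m⊖n t t')) (∣⊖∣≡∣-∣ t t')) p∣∣t-t'∣)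
             , (λ p∣∣u∣ → ⊥-elim (p∤u p∣∣u∣)) ]′
             (euclidsLemma ∣ + t - + t' ∣ ∣ u ∣ p-prime (subst (p ℕD.∣_) (ℤP.abs-* (+ t - + t') u) (∣⇒∣ᵤ p∣difference)))
    small-multiple : ∀ {d} → d < p → p ℕD.∣ d → d ≡ 0
    small-multiple {ℕ.zero}  _   _   = refl
    small-multiple {suc d}   d<p p∣d = ⊥-elim (ℕP.<⇒≱ d<p (ℕD.∣⇒≤ p∣d))

SimpleRootsMod : ℕ → Poly → Set
SimpleRootsMod p Q = ∀ (b : ℤ.ℤ) → (ℤ.+ p) ℤ∣ᵤ.∣ eval Q b → ¬ ((ℤ.+ p) ℤ∣ᵤ.∣ eval (deriv Q) b)

-- Write  ρᵢ(j) = [pⁱ ∣ Q(j)].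
-- (i) ρᵢ is pⁱ-periodic;  (ii) under the Hensel hypothesis each root s modulo
-- p^{i+1} lifts to exactly one root  s + t·p^{i+1}  modulo p^{i+2}, 0 ≤ t < p.
-- Hence every window of p^{i+1} consecutive integers contains exactly z_p
-- roots modulo p^{i+1}.
module RootCounting (p : ℕ) (p-prime : Prime p) (Q : Poly) (hensel : SimpleRootsMod p Q) where
  open import Defs using (zp)
  open import Data.Nat as ℕ using (ℕ; zero; suc; _^_)
  import Data.Nat.Properties as ℕP
  import Data.Nat.Divisibility as ℕD
  open import Data.Integer using (ℤ; +_; _+_; _*_; ∣_∣)
  import Data.Integer.Properties as ℤP
  open import Data.Integer.Divisibility.Signed
    using (_∣_; divides; ∣ᵤ⇒∣; ∣⇒∣ᵤ; ∣-refl; ∣m⇒∣m*n; ∣n⇒∣m*n; ∣m+n∣n⇒∣m; ∣m∣n⇒∣m+n; *-cancelʳ-∣)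
  open import Data.Integer.Tactic.RingSolver using (solve-∀)
  open import Data.List using (length; filter; map; upTo; applyUpTo)
  open import Data.List.Properties using (map-applyUpTo)
  open import Data.Product using (∃; _,_)
  open import Function using (id)
  open import Relation.Nullary using (yes; no)
  open import Relation.Binary.PropositionalEquality
  open FiniteSums
  open DivisibilityIndicator
  open PolynomialExpansion using (taylor; ∣-shift⇒; ∣-shift⇐)
  open Valuation p p-prime using (pᵛ≢0)
  open LinearCongruence p p-prime using (digit-exists; digit-unique)

  ∣Q∣ : ℕ → ℕ
  ∣Q∣ j = ∣ eval Q (+ j) ∣

  ρ : ℕ → ℕ → ℕ
  ρ i j = 𝟙[ p ^ i ∣ ∣Q∣ j ]

  private
    pos-shift : ∀ j t m → + (j ℕ.+ t ℕ.* m) ≡ + j + + t * + m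
    pos-shift j t m = trans (ℤP.pos-+ j (t ℕ.* m)) (cong (λ e → + j + e) (ℤP.pos-* t m))

  ∣Q∣-shift⇒ : ∀ m j t → m ℕD.∣ ∣Q∣ (j ℕ.+ t ℕ.* m) → m ℕD.∣ ∣Q∣ j
  ∣Q∣-shift⇒ m j t m∣ = ∣⇒∣ᵤ (∣-shift⇒ Q (+ m) (+ j) (+ t * + m) (∣n⇒∣m*n (+ t) ∣-refl)
    (subst (λ y → + m ∣ eval Q y) (pos-shift j t m) (∣ᵤ⇒∣ m∣)))

  ∣Q∣-shift⇐ : ∀ m j t → m ℕD.∣ ∣Q∣ j → m ℕD.∣ ∣Q∣ (j ℕ.+ t ℕ.* m)
  ∣Q∣-shift⇐ m j t m∣ = ∣⇒∣ᵤ (subst (λ y → + m ∣ eval Q y) (sym (pos-shift j t m))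
    (∣-shift⇐ Q (+ m) (+ j) (+ t * + m) (∣n⇒∣m*n (+ t) ∣-refl) (∣ᵤ⇒∣ m∣)))

  ρ-periodic : ∀ i x t → ρ i (x ℕ.+ t ℕ.* p ^ i) ≡ ρ i x
  ρ-periodic i x t with p ^ i ℕD.∣? ∣Q∣ x
  ... | yes d = 𝟙-yes (∣Q∣-shift⇐ (p ^ i) x t d)
  ... | no ¬d = 𝟙-no (λ d → ¬d (∣Q∣-shift⇒ (p ^ i) x t d))

  -- One Hensel step.  If Q(s) = c·P with P = p^{i+1}, then
  --   Q(s + t·P) = P·(c + t·Q'(s)) + p·P·W,
  -- so p·P ∣ Q(s + t·P)  iff  p ∣ c + t·Q'(s).
  module Lift (i s : ℕ) (c : ℤ) (Qs≡cP : eval Q (+ s) ≡ c * + (p ^ suc i)) where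
    P : ℕ
    P = p ^ suc i
    u : ℤ
    u = eval (deriv Q) (+ s)

    lift-expansion : ∀ t → ∃ λ W → eval Q (+ (s ℕ.+ t ℕ.* P)) ≡ + P * (c + + t * u) + + (p ℕ.* P) * W
    lift-expansion t with taylor Q (+ s) (+ t * + P)
    ... | R , expand = + t * + t * R * + (p ^ i) , (begin
      eval Q (+ (s ℕ.+ t ℕ.* P))                            ≡⟨ cong (eval Q) (pos-shift s t P) ⟩
      eval Q (+ s + + t * + P)                              ≡⟨ expand ⟩
      eval Q (+ s) + + t * + P * u + + t * + P * (+ t * + P) * R
        ≡⟨ cong (λ e → e + + t * + P * u + + t * + P * (+ t * + P) * R) Qs≡cP ⟩
      c * + P + + t * + P * u + + t * + P * (+ t * + P) * R
        ≡⟨ regroup c (+ t) u R {+ p} (ℤP.pos-* p (p ^ i)) (ℤP.pos-* p P) ⟩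
      + P * (c + + t * u) + + (p ℕ.* P) * (+ t * + t * R * + (p ^ i)) ∎)
      where
      open ≡-Reasoning
      -- uses  P = p·pⁱ  and hence  P² = (p·P)·pⁱ
      regroup : ∀ c t u R {p A P B} → P ≡ p * A → B ≡ p * P →
        c * P + t * P * u + t * P * (t * P) * R ≡ P * (c + t * u) + B * (t * t * R * A)
      regroup c t u R {p} {A} refl refl = identity c t u R p A
        where
        identity : ∀ c t u R p A → c * (p * A) + t * (p * A) * u + t * (p * A) * (t * (p * A)) * R
                                 ≡ (p * A) * (c + t * u) + (p * (p * A)) * (t * t * R * A)
        identity = solve-∀

    lift-criterion⇒ : ∀ t → p ℕ.* P ℕD.∣ ∣Q∣ (s ℕ.+ t ℕ.* P) → + p ∣ c + + t * u
    lift-criterion⇒ t pP∣ =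
      let W , expansion = lift-expansion t in
      *-cancelʳ-∣ (+ P) {{pᵛ≢0 (suc i)}}
        (subst₂ _∣_ (ℤP.pos-* p P) (ℤP.*-comm (+ P) (c + + t * u))
          (∣m+n∣n⇒∣m (subst (+ (p ℕ.* P) ∣_) expansion (∣ᵤ⇒∣ pP∣)) (∣m⇒∣m*n W ∣-refl)))

    lift-criterion⇐ : ∀ t → + p ∣ c + + t * u → p ℕ.* P ℕD.∣ ∣Q∣ (s ℕ.+ t ℕ.* P)
    lift-criterion⇐ t (divides k c+tu≡kp) =
      let W , expansion = lift-expansion t in
      ∣⇒∣ᵤ (subst (+ (p ℕ.* P) ∣_) (sym expansion)
        (∣m∣n⇒∣m+n (divides k (trans (cong (+ P *_) c+tu≡kp) (rearrange (+ P) k (+ p) (ℤP.pos-* p P))))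
                   (∣m⇒∣m*n W ∣-refl)))
      where
      rearrange : ∀ P k p {pP} → pP ≡ p * P → P * (k * p) ≡ k * pP
      rearrange P k p refl = identity P k p
        where
        identity : ∀ P k p → P * (k * p) ≡ k * (p * P)
        identity = solve-∀

  lift-count : ∀ i s → sum (λ t → ρ (suc (suc i)) (s ℕ.+ t ℕ.* p ^ suc i)) p ≡ ρ (suc i) s
  lift-count i s with p ^ suc i ℕD.∣? ∣Q∣ s
  ... | no ¬root = sum-zero _ p (λ t _ → 𝟙-no (λ root → ¬root
        (∣Q∣-shift⇒ (p ^ suc i) s t (ℕD.∣-trans (ℕD.n∣m*n p) root))))
  ... | yes root = unique-lift (∣ᵤ⇒∣ root)
    where
    p∤Q's : ¬ p ℕD.∣ ∣ eval (deriv Q) (+ s) ∣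
    p∤Q's = hensel (+ s) (ℕD.∣-trans (ℕD.m∣m*n (p ^ i)) root)
    unique-lift : + (p ^ suc i) ∣ eval Q (+ s) → sum (λ t → ρ (suc (suc i)) (s ℕ.+ t ℕ.* p ^ suc i)) p ≡ 1
    unique-lift (divides c Qs≡cP) =
      let t₀ , t₀<p , p∣c+t₀u = digit-exists c L.u p∤Q's in
      sum-single _ p t₀ t₀<p (𝟙-yes (L.lift-criterion⇐ t₀ p∣c+t₀u))
        (λ t t<p t≢t₀ → 𝟙-no (λ lifted → t≢t₀
          (digit-unique c L.u p∤Q's t<p t₀<p (L.lift-criterion⇒ t lifted) p∣c+t₀u)))
      where module L = Lift i s c Qs≡cP

  zp≡window : zp p Q ≡ window (ρ 1) 1 p
  zp≡window = begin
    length (filter (λ b → p ℕD.∣? ∣Q∣ b) (map suc (upTo p)))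
      ≡⟨ cong (λ bs → length (filter (λ b → p ℕD.∣? ∣Q∣ b) bs)) (map-applyUpTo id suc p) ⟩
    length (filter (λ b → p ℕD.∣? ∣Q∣ b) (applyUpTo suc p))
      ≡⟨ length-filter-∣ p ∣Q∣ suc p ⟩
    sum (λ l → 𝟙[ p ∣ ∣Q∣ (suc l) ]) p
      ≡⟨ sum-ext p (λ l _ → cong (λ d → 𝟙[ d ∣ ∣Q∣ (suc l) ]) (ℕP.*-identityʳ p)) ⟨
    window (ρ 1) 1 p
      ∎
    where open ≡-Reasoning

  -- Every window of p^{i+1} consecutive integers contains exactly z_p roots
  -- of Q modulo p^{i+1}: periodicity for i = 0, Hensel lifting for i + 1.
  window-count : ∀ i a → window (ρ (suc i)) a (p ^ suc i) ≡ zp p Q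
  window-count zero a = begin
    window (ρ 1) a (p ^ 1)   ≡⟨ window-periodic (ρ 1) (p ^ 1) ρ₁-periodic a ⟩
    window (ρ 1) 0 (p ^ 1)   ≡⟨ window-periodic (ρ 1) (p ^ 1) ρ₁-periodic 1 ⟨
    window (ρ 1) 1 (p ^ 1)   ≡⟨ cong (window (ρ 1) 1) (ℕP.*-identityʳ p) ⟩
    window (ρ 1) 1 p         ≡⟨ zp≡window ⟨
    zp p Q                   ∎
    where
    open ≡-Reasoning
    ρ₁-periodic : ∀ x → ρ 1 (x ℕ.+ p ^ 1) ≡ ρ 1 x
    ρ₁-periodic x = trans (cong (λ e → ρ 1 (x ℕ.+ e)) (sym (ℕP.*-identityˡ (p ^ 1)))) (ρ-periodic 1 x 1)
  window-count (suc i) a = begin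
    window (ρ (2 ℕ.+ i)) a (p ℕ.* P)                                  ≡⟨ window-residues (ρ (2 ℕ.+ i)) a P p ⟩
    window (λ x → sum (λ t → ρ (2 ℕ.+ i) (x ℕ.+ t ℕ.* P)) p) a P      ≡⟨ sum-ext P (λ l _ → lift-count i (a ℕ.+ l)) ⟩
    window (ρ (suc i)) a P                                            ≡⟨ window-count i a ⟩
    zp p Q                                                            ∎
    where
    open ≡-Reasoning
    P : ℕ
    P = p ^ suc i

-- With  q_i = ⌊L/pⁱ⌋  (computed by repeated division by
-- p = p′ + 1) and  S_K = Σ_{i=1}^{K} q_i  one has
--   (p−1)·S_K + q_K  ≤  L  ≤  (p−1)·S_K + q_K + K·(p−1),
-- so  Σ_{i≥1} ⌊L/pⁱ⌋  is  L/(p−1)  up to an error linear in the number of terms.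
module DigitSums (p′ : ℕ) where
  open import Data.Nat
  open import Data.Nat.Properties
  open import Data.Nat.DivMod
  open import Relation.Binary.PropositionalEquality
  open import Data.Nat.Tactic.RingSolver using (solve-∀)
  open FiniteSums using (sum)

  p : ℕ
  p = suc p′

  quot : ℕ → ℕ → ℕ
  quot L zero    = L
  quot L (suc i) = quot L i / p

  private
    quot-step-≤ : ∀ L i → quot L (suc i) * p ≤ quot L i
    quot-step-≤ L i = m/n*n≤m (quot L i) p

    quot-step-≥ : ∀ L i → quot L i ≤ quot L (suc i) * p + p′
    quot-step-≥ L i = begin
      quot L i                            ≡⟨ m≡m%n+[m/n]*n (quot L i) p ⟩
      quot L i % p + quot L (suc i) * p   ≤⟨ +-monoˡ-≤ _ (≤-pred (m%n<n (quot L i) p)) ⟩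
      p′ + quot L (suc i) * p             ≡⟨ +-comm p′ _ ⟩
      quot L (suc i) * p + p′             ∎
      where open ≤-Reasoning

  quot-≤ : ∀ L i → quot L i * p ^ i ≤ L
  quot-≤ L zero    = ≤-reflexive (*-identityʳ L)
  quot-≤ L (suc i) = begin
    quot L (suc i) * (p * p ^ i)   ≡⟨ *-assoc (quot L (suc i)) p (p ^ i) ⟨
    quot L (suc i) * p * p ^ i     ≤⟨ *-monoˡ-≤ (p ^ i) (quot-step-≤ L i) ⟩
    quot L i * p ^ i               ≤⟨ quot-≤ L i ⟩
    L                              ∎
    where open ≤-Reasoning

  quot-> : ∀ L i → L < suc (quot L i) * p ^ i
  quot-> L zero    = ≤-reflexive (cong suc (sym (*-identityʳ L)))
  quot-> L (suc i) = begin-strict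
    L                                    <⟨ quot-> L i ⟩
    suc (quot L i) * p ^ i               ≤⟨ *-monoˡ-≤ (p ^ i) (≤-trans (s≤s (quot-step-≥ L i)) (≤-reflexive (regroup (quot L (suc i)) p′))) ⟩
    suc (quot L (suc i)) * p * p ^ i     ≡⟨ *-assoc (suc (quot L (suc i))) p (p ^ i) ⟩
    suc (quot L (suc i)) * (p * p ^ i)   ∎
    where
    open ≤-Reasoning
    regroup : ∀ q p′ → suc (q * suc p′ + p′) ≡ suc q * suc p′
    regroup = solve-∀

  quotSum : ℕ → ℕ → ℕ
  quotSum L K = sum (λ i → quot L (suc i)) K

  quotSum-≤ : ∀ L K → p′ * quotSum L K + quot L K ≤ L
  quotSum-≤ L zero    = ≤-reflexive (cong (_+ L) (*-zeroʳ p′))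
  quotSum-≤ L (suc K) = begin
    p′ * (quotSum L K + q) + q    ≡⟨ regroup p′ (quotSum L K) q ⟩
    p′ * quotSum L K + q * p      ≤⟨ +-monoʳ-≤ (p′ * quotSum L K) (quot-step-≤ L K) ⟩
    p′ * quotSum L K + quot L K   ≤⟨ quotSum-≤ L K ⟩
    L                             ∎
    where
    open ≤-Reasoning
    q : ℕ
    q = quot L (suc K)
    regroup : ∀ p′ s q → p′ * (s + q) + q ≡ p′ * s + q * suc p′
    regroup = solve-∀

  quotSum-≥ : ∀ L K → L ≤ p′ * quotSum L K + quot L K + K * p′
  quotSum-≥ L zero    = ≤-reflexive (sym (trans (+-identityʳ _) (cong (_+ L) (*-zeroʳ p′))))
  quotSum-≥ L (suc K) = begin
    L                                            ≤⟨ quotSum-≥ L K ⟩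
    p′ * quotSum L K + quot L K + K * p′         ≤⟨ +-monoˡ-≤ (K * p′) (+-monoʳ-≤ (p′ * quotSum L K) (quot-step-≥ L K)) ⟩
    p′ * quotSum L K + (q * p + p′) + K * p′     ≡⟨ regroup p′ (quotSum L K) q K ⟩
    p′ * (quotSum L K + q) + q + suc K * p′      ∎
    where
    open ≤-Reasoning
    q : ℕ
    q = quot L (suc K)
    regroup : ∀ p′ s q K → p′ * s + (q * suc p′ + p′) + K * p′ ≡ p′ * (s + q) + q + suc K * p′
    regroup = solve-∀

-- Exponentials eventually dominate polynomials; in the form needed here:
-- for every E there is, for all large n, an exponent B with  E·B < n  and
-- c·(n+1)ᵉ < 2ᴮ.  (This bounds all valuations v_p(Q(j)), j ≤ n, by o(n).)
module Growth where
  open import Data.Nat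
  open import Data.Nat.Properties
  open import Data.Nat.DivMod
  open import Data.Product using (∃; _,_; _×_)
  open import Relation.Binary.PropositionalEquality
  open import Data.Nat.Tactic.RingSolver using (solve-∀)

  n<2^n : ∀ n → n < 2 ^ n
  n<2^n zero    = s≤s z≤n
  n<2^n (suc n) = begin-strict
    suc n           ≤⟨ n<2^n n ⟩
    2 ^ n           <⟨ m<m+n (2 ^ n) (m^n>0 2 n) ⟩
    2 ^ n + 2 ^ n   ≡⟨ cong (2 ^ n +_) (+-identityʳ (2 ^ n)) ⟨
    2 ^ suc n       ∎
    where open ≤-Reasoning

  ^-distribʳ-* : ∀ a b e → (a * b) ^ e ≡ a ^ e * b ^ e
  ^-distribʳ-* a b zero    = refl
  ^-distribʳ-* a b (suc e) = trans (cong (a * b *_) (^-distribʳ-* a b e)) (interchange a b (a ^ e) (b ^ e))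
    where
    interchange : ∀ a b x y → a * b * (x * y) ≡ a * x * (b * y)
    interchange = solve-∀

  <-*-suc-/ : ∀ q d .{{_ : NonZero d}} → q < d * suc (q / d)
  <-*-suc-/ q d = begin-strict
    q                    ≡⟨ m≡m%n+[m/n]*n q d ⟩
    q % d + q / d * d    <⟨ +-monoˡ-< (q / d * d) (m%n<n q d) ⟩
    d + q / d * d        ≡⟨ *-comm (suc (q / d)) d ⟩
    d * suc (q / d)      ∎
    where open ≤-Reasoning

  N≤n/d : ∀ N n d .{{_ : NonZero d}} → d * N ≤ n → N ≤ n / d
  N≤n/d N n d dN≤n = ≤-trans (≤-reflexive (sym (m*n/n≡m N d))) (/-monoˡ-≤ d (≤-trans (≤-reflexive (*-comm N d)) dN≤n))

  -- c·(q+1)ᵉ < 2^q for large q, by induction on e: halve q at each step.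
  poly<exp : ∀ e c → ∃ λ N → ∀ q → N ≤ q → c * suc q ^ e < 2 ^ q
  poly<exp zero    c = c , λ q c≤q → ≤-<-trans (≤-reflexive (*-identityʳ c)) (≤-<-trans c≤q (n<2^n q))
  poly<exp (suc e) c with poly<exp e (c * 2 ^ suc e)
  ... | N , bound = 2 * N , λ q 2N≤q → let r = q / 2 in begin-strict
    c * (suc q * suc q ^ e)                 ≤⟨ *-monoʳ-≤ c (^-monoˡ-≤ (suc e) (<-*-suc-/ q 2)) ⟩
    c * (2 * suc r) ^ suc e                 ≡⟨ cong (c *_) (^-distribʳ-* 2 (suc r) (suc e)) ⟩
    c * (2 ^ suc e * suc r ^ suc e)         ≡⟨ regroup c (2 ^ suc e) (suc r) (suc r ^ e) ⟩
    c * 2 ^ suc e * suc r ^ e * suc r       <⟨ *-monoˡ-< (suc r) (bound r (N≤n/d N q 2 2N≤q)) ⟩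
    2 ^ r * suc r                           ≤⟨ *-monoʳ-≤ (2 ^ r) (n<2^n r) ⟩
    2 ^ r * 2 ^ r                           ≡⟨ ^-distribˡ-+-* 2 r r ⟨
    2 ^ (r + r)                             ≤⟨ ^-monoʳ-≤ 2 (r+r≤q q) ⟩
    2 ^ q                                   ∎
    where
    open ≤-Reasoning
    regroup : ∀ c P s X → c * (P * (s * X)) ≡ c * P * X * s
    regroup = solve-∀
    r+r≤q : ∀ q → q / 2 + q / 2 ≤ q
    r+r≤q q = ≤-trans (≤-reflexive (trans (cong (q / 2 +_) (sym (+-identityʳ (q / 2)))) (*-comm 2 (q / 2)))) (m/n*n≤m q 2)

  *-/-suc-< : ∀ E n → 0 < n → E * (n / suc E) < n
  *-/-suc-< E n 0<n with n / suc E in n/D≡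
  ... | zero  = subst (_< n) (sym (*-zeroʳ E)) 0<n
  ... | suc b = begin-strict
    E * suc b             <⟨ m<n+m (E * suc b) z<s ⟩
    suc b + E * suc b     ≡⟨ *-comm (suc E) (suc b) ⟩
    suc b * suc E         ≡⟨ cong (_* suc E) n/D≡ ⟨
    n / suc E * suc E     ≤⟨ m/n*n≤m n (suc E) ⟩
    n                     ∎
    where open ≤-Reasoning

  small-exponent : ∀ E e c → ∃ λ N → ∀ n → N ≤ n → ∃ λ B → E * B < n × c * suc n ^ e < 2 ^ B
  small-exponent E e c with poly<exp e (c * D ^ e)
    where
    D : ℕ
    D = suc E
  ... | N , bound = suc (D * N) , λ n N<n → n / D , *-/-suc-< E n (≤-trans z<s N<n) , (begin-strict
    c * suc n ^ e                 ≤⟨ *-monoʳ-≤ c (^-monoˡ-≤ e (<-*-suc-/ n D)) ⟩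
    c * (D * suc (n / D)) ^ e     ≡⟨ cong (c *_) (^-distribʳ-* D (suc (n / D)) e) ⟩
    c * (D ^ e * suc (n / D) ^ e) ≡⟨ *-assoc c (D ^ e) _ ⟨
    c * D ^ e * suc (n / D) ^ e   <⟨ bound (n / D) (N≤n/d N n D (<⇒≤ N<n)) ⟩
    2 ^ (n / D)                   ∎)
    where
    open ≤-Reasoning
    D : ℕ
    D = suc E

module PolynomialSize where
  open import Data.Nat
  open import Data.Nat.Properties
  open import Data.Integer as ℤ using (ℤ; +_; ∣_∣)
  import Data.Integer.Properties as ℤP
  open import Data.List using ([]; _∷_; length)
  open import Relation.Binary.PropositionalEquality
  open import Data.Nat.Tactic.RingSolver using (solve-∀)

  norm : Poly → ℕ
  norm []       = 0
  norm (a ∷ as) = ∣ a ∣ + norm as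

  eval-bound : ∀ Q j → ∣ eval Q (+ j) ∣ ≤ norm Q * suc j ^ length Q
  eval-bound []       j = z≤n
  eval-bound (a ∷ as) j = begin
    ∣ a ℤ.+ + j ℤ.* eval as (+ j) ∣                 ≤⟨ ℤP.∣i+j∣≤∣i∣+∣j∣ a _ ⟩
    ∣ a ∣ + ∣ + j ℤ.* eval as (+ j) ∣               ≡⟨ cong (λ e → ∣ a ∣ + e) (ℤP.abs-* (+ j) (eval as (+ j))) ⟩
    ∣ a ∣ + j * ∣ eval as (+ j) ∣                   ≤⟨ +-mono-≤ (m≤m*n ∣ a ∣ (suc j * X) {{>-nonZero (m^n>0 (suc j) (suc (length as)))}})
                                                                (*-mono-≤ (n≤1+n j) (eval-bound as j)) ⟩
    ∣ a ∣ * (suc j * X) + suc j * (norm as * X)      ≡⟨ regroup ∣ a ∣ (norm as) (suc j) X ⟩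
    (∣ a ∣ + norm as) * (suc j * X)                 ∎
    where
    open ≤-Reasoning
    X : ℕ
    X = suc j ^ length as
    regroup : ∀ a C s X → a * (s * X) + s * (C * X) ≡ (a + C) * (s * X)
    regroup = solve-∀

module Asymptotics (p′ : ℕ) (p-prime : Prime (ℕ.suc p′)) (Q : Poly) (hensel : SimpleRootsMod (ℕ.suc p′) Q)
    (n₀ : ℕ) (roots-below-n₀ : ∀ (m : ℕ) → 0 ℕ.< m → eval Q (ℤ.+ m) ≡ ℤ.+ 0 → m ℕ.< n₀) where
  open import Defs using (t; zp)
  open import Data.Nat
  open import Data.Nat.Properties
  open import Data.Integer using (+_) renaming (∣_∣ to abs)
  import Data.Integer.Properties as ℤP
  open import Data.List using (length)
  open import Data.Product using (∃; _,_)
  open import Data.Empty using (⊥-elim)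
  open import Relation.Nullary using (yes; no)
  open import Relation.Binary.PropositionalEquality
  open import Data.Nat.Tactic.RingSolver using (solve-∀)
  open FiniteSums
  open Valuation (suc p′) p-prime
  open RootCounting (suc p′) p-prime Q hensel
  open DigitSums p′ using (p; quot; quot-≤; quot->; quotSum; quotSum-≤; quotSum-≥)
  open NaturalDistance using (distance<)
  open PolynomialSize using (norm; eval-bound)
  open Growth using (n<2^n; small-exponent)

  z : ℕ
  z = zp p Q

  -- Σ_{n₀ < j ≤ n} g(j), by the same recursion that defines t.
  T : (ℕ → ℕ) → ℕ → ℕ
  T g zero    = 0
  T g (suc n) with suc n ≤? n₀
  ... | yes _ = 0
  ... | no  _ = g (suc n) + T g n

  T-mono : ∀ {g h} n → (∀ j → n₀ < j → j ≤ n → g j ≤ h j) → T g n ≤ T h n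
  T-mono zero    g≤h = z≤n
  T-mono (suc n) g≤h with suc n ≤? n₀
  ... | yes _   = z≤n
  ... | no  n≥n₀ = +-mono-≤ (g≤h (suc n) (≰⇒> n≥n₀) ≤-refl)
                           (T-mono n (λ j n₀<j j≤n → g≤h j n₀<j (m≤n⇒m≤1+n j≤n)))

  T-window : ∀ g n → T g n ≡ window g (suc n₀) (n ∸ n₀)
  T-window g zero = cong (window g (suc n₀)) (sym (0∸n≡0 n₀))
  T-window g (suc n) with suc n ≤? n₀
  ... | yes n<n₀ = cong (window g (suc n₀)) (sym (m≤n⇒m∸n≡0 n<n₀))
  ... | no  n≮n₀ = begin
    g (suc n) + T g n                                              ≡⟨ cong₂ _+_ (cong g (cong suc (sym (m+[n∸m]≡n n₀≤n)))) (T-window g n) ⟩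
    g (suc n₀ + (n ∸ n₀)) + window g (suc n₀) (n ∸ n₀)              ≡⟨ +-comm (g (suc n₀ + (n ∸ n₀))) _ ⟩
    window g (suc n₀) (suc (n ∸ n₀))                                ≡⟨ cong (window g (suc n₀)) (+-∸-assoc 1 n₀≤n) ⟨
    window g (suc n₀) (suc n ∸ n₀)                                  ∎
    where
    open ≡-Reasoning
    n₀≤n : n₀ ≤ n
    n₀≤n = ≤-pred (≰⇒> n≮n₀)

  -- Q has no zeros beyond n₀, so the valuations v_p(Q(j)), j > n₀, are defined.
  ∣Q∣-pos : ∀ j → n₀ < j → 0 < ∣Q∣ j
  ∣Q∣-pos j n₀<j with ∣Q∣ j in ∣Qj∣≡
  ... | suc _ = z<s
  ... | zero  = ⊥-elim (<-asym n₀<j (roots-below-n₀ j (≤-trans z<s n₀<j) (ℤP.∣i∣≡0⇒i≡0 ∣Qj∣≡)))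

  vQ : ℕ → ℕ
  vQ j = val (∣Q∣ j)

  t-valuation : ∀ n → Val (abs (t Q n₀ n)) (T vQ n)
  t-valuation zero = val-1
  t-valuation (suc n) with suc n ≤? n₀
  ... | yes _ = val-1
  ... | no  n≮n₀ = subst (λ x → Val x (vQ (suc n) + T vQ n)) (sym (ℤP.abs-* (eval Q (+ suc n)) (t Q n₀ n)))
                     (val-* (val-spec (∣Q∣ (suc n)) (∣Q∣-pos (suc n) (≰⇒> n≮n₀))) (t-valuation n))

  T-swap : ∀ K n → T (λ j → sum (λ i → ρ (suc i) j) K) n ≡ sum (λ i → window (ρ (suc i)) (suc n₀) (n ∸ n₀)) K
  T-swap K n = trans (T-window _ n) (sum-swap (λ l i → ρ (suc i) (suc n₀ + l)) (n ∸ n₀) K)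

  -- Lower bound, truncating every valuation at a fixed level K.
  valuation-≥ : ∀ K n → quotSum (n ∸ n₀) K * z ≤ T vQ n
  valuation-≥ K n = begin
    quotSum L K * z                                     ≡⟨ sum-*ʳ (λ i → quot L (suc i)) z K ⟨
    sum (λ i → quot L (suc i) * z) K                    ≤⟨ sum-mono K (λ i → window-≥ (ρ (suc i)) (p ^ suc i) z (window-count i)
                                                                          (suc n₀) L (quot L (suc i)) (quot-≤ L (suc i))) ⟩
    sum (λ i → window (ρ (suc i)) (suc n₀) L) K         ≡⟨ T-swap K n ⟨
    T (λ j → sum (λ i → ρ (suc i) j) K) n               ≤⟨ T-mono n (λ j n₀<j _ → truncation-≤ j n₀<j) ⟩
    T vQ n                                              ∎
    where
    open ≤-Reasoning
    L : ℕ
    L = n ∸ n₀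
    truncation-≤ : ∀ j → n₀ < j → sum (λ i → ρ (suc i) j) K ≤ vQ j
    truncation-≤ j n₀<j = ≤-trans (≤-reflexive (truncated-valuation (val-spec (∣Q∣ j) (∣Q∣-pos j n₀<j)) K)) (m⊓n≤n K (vQ j))

  -- Upper bound, when every |Q(j)|, j ≤ n, is below p^{B+1}: then no
  -- valuation exceeds B and truncating at B loses nothing.
  valuation-≤ : ∀ B n → (∀ j → j ≤ n → ∣Q∣ j < p ^ suc B) → T vQ n ≤ quotSum (n ∸ n₀) B * z + B * z
  valuation-≤ B n small = begin
    T vQ n                                              ≤⟨ T-mono n (λ j n₀<j j≤n → untruncated j n₀<j j≤n) ⟩
    T (λ j → sum (λ i → ρ (suc i) j) B) n               ≡⟨ T-swap B n ⟩
    sum (λ i → window (ρ (suc i)) (suc n₀) L) B         ≤⟨ sum-mono B (λ i → window-≤ (ρ (suc i)) (p ^ suc i) z (window-count i)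
                                                                          (suc n₀) L (suc (quot L (suc i))) (<⇒≤ (quot-> L (suc i)))) ⟩
    sum (λ i → z + quot L (suc i) * z) B                ≡⟨ sum-ext B (λ i _ → +-comm z _) ⟩
    sum (λ i → quot L (suc i) * z + z) B                ≡⟨ sum-distrib (λ i → quot L (suc i) * z) (λ _ → z) B ⟩
    sum (λ i → quot L (suc i) * z) B + sum (λ _ → z) B  ≡⟨ cong₂ _+_ (sum-*ʳ (λ i → quot L (suc i)) z B) (sum-const z B) ⟩
    quotSum L B * z + B * z                             ∎
    where
    open ≤-Reasoning
    L : ℕ
    L = n ∸ n₀
    untruncated : ∀ j → n₀ < j → j ≤ n → vQ j ≤ sum (λ i → ρ (suc i) j) B
    untruncated j n₀<j j≤n = ≤-trans
      (≤-reflexive (sym (m≥n⇒m⊓n≡n (val-≤ B Qⱼ (∣Q∣-pos j n₀<j) (small j j≤n)))))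
      (≤-reflexive (sym (truncated-valuation Qⱼ B)))
      where Qⱼ = val-spec (∣Q∣ j) (∣Q∣-pos j n₀<j)

  lower-estimate : ∀ M K n → 2 * M * z < p ^ K → 2 * M * (z * n₀ + z * (K * p′)) < n →
    M * (z * n) < M * (p′ * T vQ n) + n
  lower-estimate M K n 2Mz<pᴷ 2MC<n = begin-strict
    M * (z * n)                          ≤⟨ *-monoʳ-≤ M zn≤ ⟩
    M * (p′ * T vQ n + (C + z * q))      ≡⟨ *-distribˡ-+ M (p′ * T vQ n) (C + z * q) ⟩
    M * (p′ * T vQ n) + M * (C + z * q)  <⟨ +-monoʳ-< (M * (p′ * T vQ n)) error<n ⟩
    M * (p′ * T vQ n) + n                ∎
    where
    open ≤-Reasoning
    L : ℕ
    L = n ∸ n₀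
    q S C : ℕ
    q = quot L K
    S = quotSum L K
    C = z * n₀ + z * (K * p′)
    zn≤ : z * n ≤ p′ * T vQ n + (C + z * q)
    zn≤ = begin
      z * n                                   ≤⟨ *-monoʳ-≤ z (m≤n+m∸n n n₀) ⟩
      z * (n₀ + L)                            ≤⟨ *-monoʳ-≤ z (+-monoʳ-≤ n₀ (quotSum-≥ L K)) ⟩
      z * (n₀ + (p′ * S + q + K * p′))        ≡⟨ regroup z n₀ p′ S q K ⟩
      p′ * (S * z) + (C + z * q)              ≤⟨ +-monoˡ-≤ (C + z * q) (*-monoʳ-≤ p′ (valuation-≥ K n)) ⟩
      p′ * T vQ n + (C + z * q)               ∎
      where
      regroup : ∀ z n₀ p′ S q K → z * (n₀ + (p′ * S + q + K * p′)) ≡ p′ * (S * z) + (z * n₀ + z * (K * p′) + z * q)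
      regroup = solve-∀
    2Mzq≤n : 2 * M * z * q ≤ n
    2Mzq≤n = begin
      2 * M * z * q   ≤⟨ *-monoˡ-≤ q (<⇒≤ 2Mz<pᴷ) ⟩
      p ^ K * q       ≡⟨ *-comm (p ^ K) q ⟩
      q * p ^ K       ≤⟨ quot-≤ L K ⟩
      L               ≤⟨ m∸n≤m n n₀ ⟩
      n               ∎
    error<n : M * (C + z * q) < n
    error<n = *-cancelˡ-< 2 _ n (begin-strict
      2 * (M * (C + z * q))         ≡⟨ regroup M C z q ⟩
      2 * M * C + 2 * M * z * q     <⟨ +-mono-<-≤ 2MC<n 2Mzq≤n ⟩
      n + n                         ≡⟨ cong (λ e → n + e) (+-identityʳ n) ⟨
      2 * n                         ∎)
      where
      regroup : ∀ M C z q → 2 * (M * (C + z * q)) ≡ 2 * M * C + 2 * M * z * q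
      regroup = solve-∀

  upper-estimate : ∀ M B n → (∀ j → j ≤ n → ∣Q∣ j < p ^ suc B) → M * p′ * z * B < n →
    M * (p′ * T vQ n) < M * (z * n) + n
  upper-estimate M B n small MpzB<n = begin-strict
    M * (p′ * T vQ n)                    ≤⟨ *-monoʳ-≤ M (*-monoʳ-≤ p′ (valuation-≤ B n small)) ⟩
    M * (p′ * (S * z + B * z))           ≡⟨ regroup M p′ S z B ⟩
    M * ((p′ * S) * z) + M * p′ * z * B  ≤⟨ +-monoˡ-≤ (M * p′ * z * B) (*-monoʳ-≤ M (*-monoˡ-≤ z p′S≤n)) ⟩
    M * (n * z) + M * p′ * z * B         ≡⟨ cong (λ e → M * e + M * p′ * z * B) (*-comm n z) ⟩
    M * (z * n) + M * p′ * z * B         <⟨ +-monoʳ-< (M * (z * n)) MpzB<n ⟩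
    M * (z * n) + n                      ∎
    where
    open ≤-Reasoning
    L : ℕ
    L = n ∸ n₀
    S : ℕ
    S = quotSum L B
    p′S≤n : p′ * S ≤ n
    p′S≤n = ≤-trans (m≤m+n (p′ * S) (quot L B)) (≤-trans (quotSum-≤ L B) (m∸n≤m n n₀))
    regroup : ∀ M p′ S z B → M * (p′ * (S * z + B * z)) ≡ M * ((p′ * S) * z) + M * p′ * z * B
    regroup = solve-∀

  -- For every M, eventually  M·|(p−1)·v_p(t_n) − z·n| < n:  choose the
  -- truncation level K = 2Mz for the lower estimate and, by the growth lemma,
  -- a valuation bound B with M(p−1)zB < n for the upper one.
  valuation-asymptotics : ∀ M → ∃ λ N → ∀ n → N ≤ n → M * ∣ p′ * T vQ n - z * n ∣ < n
  valuation-asymptotics M with small-exponent (M * p′ * z) (length Q) (norm Q)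
  ... | N′ , exponent = suc (2 * M * C) ⊔ N′ , asymptotics
    where
    K C : ℕ
    K = 2 * M * z
    C = z * n₀ + z * (K * p′)
    2Mz<pᴷ : 2 * M * z < p ^ K
    2Mz<pᴷ = <-≤-trans (n<2^n K) (^-monoˡ-≤ K 1<p)
    asymptotics : ∀ n → suc (2 * M * C) ⊔ N′ ≤ n → M * ∣ p′ * T vQ n - z * n ∣ < n
    asymptotics n N≤n with exponent n (m⊔n≤o⇒n≤o _ N′ N≤n)
    ... | B , MpzB<n , size<2ᴮ = subst (_< n) (sym (*-distribˡ-∣-∣ M (p′ * T vQ n) (z * n)))
          (distance< (M * (p′ * T vQ n)) (M * (z * n)) n {{>-nonZero (≤-trans z<s 2MC<n)}}
            (upper-estimate M B n small MpzB<n) (lower-estimate M K n 2Mz<pᴷ 2MC<n))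
      where
      2MC<n : 2 * M * C < n
      2MC<n = m⊔n≤o⇒m≤o _ N′ N≤n
      small : ∀ j → j ≤ n → ∣Q∣ j < p ^ suc B
      small j j≤n = begin-strict
        ∣Q∣ j                          ≤⟨ eval-bound Q j ⟩
        norm Q * suc j ^ length Q      ≤⟨ *-monoʳ-≤ (norm Q) (^-monoˡ-≤ (length Q) (s≤s j≤n)) ⟩
        norm Q * suc n ^ length Q      <⟨ size<2ᴮ ⟩
        2 ^ B                          ≤⟨ ^-monoˡ-≤ B 1<p ⟩
        p ^ B                          ≤⟨ ^-monoʳ-≤ p (n≤1+n B) ⟩
        p ^ suc B                      ∎
        where open ≤-Reasoning

module RationalEstimate where
  open import Data.Nat as ℕ using (ℕ; zero; suc)
  import Data.Nat.Properties as ℕP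
  open import Data.Integer as ℤ using (ℤ; +_; -[1+_]; _⊖_; +<+)
  import Data.Integer.Properties as ℤP
  open import Data.Integer.Tactic.RingSolver using (solve-∀)
  open import Data.Rational using (ℚ; mkℚ; 0ℚ; _/_; _-_; -_; ∣_∣; toℚᵘ; _<_; *<*)
  open import Data.Rational.Properties
    using (toℚᵘ-cancel-<; toℚᵘ-fromℚᵘ; toℚᵘ-homo-+; toℚᵘ-homo‿-; toℚᵘ-homo-∣-∣)
  import Data.Rational.Unnormalised as U
  import Data.Rational.Unnormalised.Properties as UP
  open import Data.Empty using (⊥-elim)
  open import Relation.Binary.PropositionalEquality
  open NaturalDistance using (∣⊖∣≡∣-∣)

  numerator-distance : ∀ x y n → ℤ.∣ + x ℤ.* + 1 ℤ.+ ℤ.- (+ y) ℤ.* + n ∣ ≡ ℕ.∣ x - y ℕ.* n ∣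
  numerator-distance x y n = begin
    ℤ.∣ + x ℤ.* + 1 ℤ.+ ℤ.- (+ y) ℤ.* + n ∣  ≡⟨ cong ℤ.∣_∣ (regroup (+ x) (+ y) (+ n)) ⟩
    ℤ.∣ + x ℤ.- + y ℤ.* + n ∣               ≡⟨ cong (λ w → ℤ.∣ + x ℤ.- w ∣) (ℤP.pos-* y n) ⟨
    ℤ.∣ + x ℤ.- + (y ℕ.* n) ∣               ≡⟨ cong ℤ.∣_∣ (ℤP.[+m]-[+n]≡m⊖n x (y ℕ.* n)) ⟩
    ℤ.∣ x ⊖ y ℕ.* n ∣                       ≡⟨ ∣⊖∣≡∣-∣ x (y ℕ.* n) ⟩
    ℕ.∣ x - y ℕ.* n ∣                         ∎
    where
    open ≡-Reasoning
    regroup : ∀ x y n → x ℤ.* ℤ.1ℤ ℤ.+ ℤ.- y ℤ.* n ≡ x ℤ.- y ℤ.* n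
    regroup = solve-∀

  -- With ε = a/d (a ≥ 1): |x/n − y| = |x − y·n|/n < 1/d ≤ ε.
  close-to-integer : ∀ x y m (ε : ℚ) → 0ℚ < ε →
    ℚ.denominatorℕ ε ℕ.* ℕ.∣ x - y ℕ.* suc m ∣ ℕ.< suc m →
    ∣ (+ x / suc m) - (+ y / 1) ∣ < ε
  close-to-integer x y m (mkℚ (+ zero) d _) (*<* 0<0) _ = ⊥-elim (ℤP.<-irrefl refl 0<0)
  close-to-integer x y m (mkℚ -[1+ a ] d _) (*<* ()) _
  close-to-integer x y m ε@(mkℚ (+ suc a) d _) _ close =
    toℚᵘ-cancel-< (UP.<-respˡ-≃ (UP.≃-sym as-unnormalised) (U.*<* cross-multiplied))
    where
    n : ℕ
    n = suc m
    X Y : U.ℚᵘ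
    X = U.mkℚᵘ (+ x) m
    Y = U.mkℚᵘ (+ y) 0
    r : ℚ
    r = (+ x / n) - (+ y / 1)
    as-unnormalised : toℚᵘ ∣ r ∣ U.≃ U.∣ X U.- Y ∣
    as-unnormalised = UP.≃-trans (toℚᵘ-homo-∣-∣ r) (UP.∣-∣-cong
      (UP.≃-trans (toℚᵘ-homo-+ (+ x / n) (- (+ y / 1)))
       (UP.+-cong (toℚᵘ-fromℚᵘ X) (UP.≃-trans (toℚᵘ-homo‿- (+ y / 1)) (UP.-‿cong (toℚᵘ-fromℚᵘ Y))))))
    dist : ℕ
    dist = ℕ.∣ x - y ℕ.* n ∣
    ℕ-bound : dist ℕ.* suc d ℕ.< suc a ℕ.* (n ℕ.* 1)
    ℕ-bound = ℕP.<-≤-trans (subst (ℕ._< n) (ℕP.*-comm (suc d) dist) close)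
                (ℕP.≤-trans (ℕP.≤-reflexive (sym (ℕP.*-identityʳ n))) (ℕP.m≤n*m (n ℕ.* 1) (suc a)))
    cross-multiplied : + ℤ.∣ + x ℤ.* + 1 ℤ.+ ℤ.- (+ y) ℤ.* + n ∣ ℤ.* + suc d ℤ.< + suc a ℤ.* + (n ℕ.* 1)
    cross-multiplied = subst₂ ℤ._<_
      (trans (ℤP.pos-* dist (suc d)) (cong (λ w → + w ℤ.* + suc d) (sym (numerator-distance x y n))))
      (ℤP.pos-* (suc a) (n ℕ.* 1))
      (+<+ ℕ-bound)

open import Defs
open import Data.Nat using (ℕ; suc; _<_; _≤_; _∸_; _*_)
open import Data.Nat.Primality using (Prime)
open import Data.Integer using (ℤ; +_)
open import Data.Integer.Divisibility using (_∣_)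
open import Data.Rational using (ℚ; 0ℚ; _/_; _-_; ∣_∣)
open import Data.Rational using () renaming (_<_ to _<ℚ_)
open import Data.Product using (∃)
open import Relation.Nullary using (¬_)
open import Relation.Binary.PropositionalEquality using (_≡_)

open import Data.Nat using (zero; NonZero)
open import Data.Nat.Primality using (prime⇒nonZero)
open import Data.Nat.Properties using (m≤n⇒m≤1+n)
open import Data.Product using (_,_; proj₁; proj₂)
open import Data.Empty using (⊥-elim)
open import Relation.Binary.PropositionalEquality using (subst)

theorem1p2 : (p : ℕ) → Prime p → (Q : Poly) →
    (∀ (b : ℤ) → (+ p) ∣ eval Q b → ¬ ((+ p) ∣ eval (deriv Q) b)) →
    (n₀ : ℕ) → (∀ (m : ℕ) → 0 < m → eval Q (+ m) ≡ + 0 → m < n₀) →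
    ∀ (ε : ℚ) → 0ℚ <ℚ ε → ∃ λ (N : ℕ) → ∀ (m : ℕ) → N ≤ m → ∀ (k : ℕ) →
      HasVal p (t Q n₀ (suc m)) k →
      ∣ ((+ ((p ∸ 1) * k)) / suc m) - ((+ zp p Q) / 1) ∣ <ℚ ε
theorem1p2 zero      p-prime = ⊥-elim (NonZero.nonZero (prime⇒nonZero p-prime))
theorem1p2 (suc p′) p-prime Q hensel n₀ roots ε 0<ε = N , λ m N≤m k t-val →
  close-to-integer ((suc p′ ∸ 1) * k) (zp (suc p′) Q) m ε 0<ε
    (subst (λ v → M * ℕ.∣ p′ * v - zp (suc p′) Q * suc m ∣ < suc m)
      (val-unique (t-valuation (suc m)) (HasVal⇒Val t-val))
      (eventually (suc m) (m≤n⇒m≤1+n N≤m)))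
  where
  open Asymptotics p′ p-prime Q hensel n₀ roots using (T; vQ; t-valuation; valuation-asymptotics)
  open Valuation (suc p′) p-prime using (val-unique; HasVal⇒Val)
  open RationalEstimate using (close-to-integer)
  M : ℕ
  M = ℚ.denominatorℕ ε
  N : ℕ
  N = proj₁ (valuation-asymptotics M)
  eventually : ∀ n → N ≤ n → M * ℕ.∣ p′ * T vQ n - zp (suc p′) Q * n ∣ < n
  eventually = proj₂ (valuation-asymptotics M)
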